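{- Fix an integer $k \ge 2$ and an integer $n \ge 3^k$, and write $n = z\cdot 3^k + R$ with integers $z \ge 1$ and $0 \le R < 3^k$. Let $H$ be the graph with vertex set $[3]^k = \{(\alpha_1,\dots,\alpha_k) : \alpha_i \in \{1,2,3\}\}$ in which two vectors are adjacent if and only if they differ in exactly one coordinate (i.e. $H = K_3 \,\square\, \cdots \,\square\, K_3$, $k$ factors). Let $H'$ be the graph obtained from the disjoint union of a copy of $H$ and a complete graph $K_R$ by joining every vertex of $K_R$ to exactly the three vertices $(\alpha_1,1,1,\dots,1)$, $\alpha_1 \in \{1,2,3\}$, of the copy of $H$. Let $G$ be the disjoint union of $z-1$ copies of $H$ and one copy of $H'$. Then $G$ is $K_{1,k+1}$-induced-saturated.
   Context: All graphs are finite and simple; $\square$ denotes the Cartesian product and $[3]=\{1,2,3\}$. For a graph $F$, a graph $G$ is $F$-induced-saturated if $G$ contains no induced subgraph isomorphic to $F$, but for every pair of distinct vertices $u,v$ of $G$, the graph obtained from $G$ by adding the edge $uv$ (if $uv\notin E(G)$) or deleting it (if $uv\in E(G)$) contains an induced subgraph isomorphic to $F$. -}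

module Defs where

open import Data.Nat using (ℕ; zero; suc; _^_; _≡ᵇ_)
open import Data.Bool using (Bool; true; false; not; _∧_; _∨_; if_then_else_; _xor_)
open import Data.Fin using (Fin; toℕ) renaming (_≟_ to _≟F_)
open import Data.Vec using (Vec; []; _∷_)
open import Data.Product using (Σ; _×_; _,_)
open import Data.Sum using (_⊎_; inj₁; inj₂)
import Data.Sum.Properties as SumP
import Data.Product.Properties as ProdP
import Data.Vec.Properties as VecP
open import Relation.Nullary using (¬_)
open import Relation.Nullary.Decidable using (⌊_⌋)
open import Relation.Binary.Definitions using (DecidableEquality)
open import Relation.Binary.PropositionalEquality using (_≡_; _≢_)
open import Function.Definitions using (Injective)

-- A (finite, simple) graph given by a vertex type with decidable equality
-- and a Boolean adjacency relation (only used on pairs of distinct vertices).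
record Graph : Set₁ where
  field
    V     : Set
    _≟V_  : DecidableEquality V
    adj   : V → V → Bool
open Graph public

ContainsInduced : Graph → Graph → Set
ContainsInduced F G =
  Σ (V F → V G) λ f →
    Injective _≡_ _≡_ f ×
    (∀ x y → x ≢ y → adj G (f x) (f y) ≡ adj F x y)

toggle : (G : Graph) → V G → V G → Graph
toggle G u v = record
  { V = V G
  ; _≟V_ = _≟V_ G
  ; adj = λ x y →
      if (⌊ _≟V_ G x u ⌋ ∧ ⌊ _≟V_ G y v ⌋) ∨ (⌊ _≟V_ G x v ⌋ ∧ ⌊ _≟V_ G y u ⌋)
      then not (adj G x y) else adj G x y
  }

InducedSaturated : Graph → Graph → Set
InducedSaturated F G =
  ¬ ContainsInduced F G ×
  (∀ (u v : V G) → u ≢ v → ContainsInduced F (toggle G u v))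

isZero : ∀ {m} → Fin m → Bool
isZero i = toℕ i ≡ᵇ 0

Star : ℕ → Graph
Star m = record
  { V = Fin (suc m)
  ; _≟V_ = _≟F_
  ; adj = λ i j → isZero i xor isZero j
  }

-- [3] = {1,2,3} is represented by Fin 3, with coordinate value 1 ↦ Fin zero.
-- Number of coordinates where two vectors in [3]^k differ.
diffCount : ∀ {k} → Vec (Fin 3) k → Vec (Fin 3) k → ℕ
diffCount [] [] = 0
diffCount (a ∷ as) (b ∷ bs) =
  if ⌊ a ≟F b ⌋ then diffCount as bs else suc (diffCount as bs)

hamAdj : ∀ {k} → Vec (Fin 3) k → Vec (Fin 3) k → Bool
hamAdj α β = diffCount α β ≡ᵇ 1

allOne : ∀ {k} → Vec (Fin 3) k → Bool
allOne [] = true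
allOne (a ∷ as) = isZero a ∧ allOne as

isAnchor : ∀ {k} → Vec (Fin 3) k → Bool
isAnchor [] = false
isAnchor (a ∷ as) = allOne as

-- Vertices of G(k,z,R): z copies of H = K_3^{□k}, indexed by Fin z, plus the
-- R vertices of K_R.  The copy with index 0 together with K_R forms H'.
GV : ℕ → ℕ → ℕ → Set
GV k z R = (Fin z × Vec (Fin 3) k) ⊎ Fin R

GV-dec : ∀ k z R → DecidableEquality (GV k z R)
GV-dec k z R = SumP.≡-dec (ProdP.≡-dec _≟F_ (VecP.≡-dec _≟F_)) _≟F_

GAdj : ∀ k z R → GV k z R → GV k z R → Bool
GAdj k z R (inj₁ (c , α)) (inj₁ (d , β)) = ⌊ c ≟F d ⌋ ∧ hamAdj α β
GAdj k z R (inj₂ r) (inj₂ s) = not ⌊ r ≟F s ⌋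
GAdj k z R (inj₁ (c , α)) (inj₂ r) = isZero c ∧ isAnchor α
GAdj k z R (inj₂ r) (inj₁ (c , α)) = isZero c ∧ isAnchor α

Gconstr : ℕ → ℕ → ℕ → Graph
Gconstr k z R = record { V = GV k z R ; _≟V_ = GV-dec k z R ; adj = GAdj k z R }

-- Every vertex of G has its neighbourhood covered by k cliques: the neighbours of a vertex α
-- of a copy of H fall into classes according to the coordinate in which they differ from α
-- (the K_R-neighbours of an anchor joining the class of the first coordinate, which then
-- consists of anchors), and the neighbourhood of a vertex of K_R is the rest of K_R together
-- with the three anchors.  By pigeonhole, no k+1 neighbours of a vertex are pairwise
-- non-adjacent, so G has no induced K_{1,k+1}.
--
-- Toggling a pair uv creates one.  If uv is a non-edge with u in a copy of H, change each
-- coordinate j of u to a value different from u_j and from v_j (from 1 if v ∈ K_R): these k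
-- neighbours of u are pairwise at distance 2 and non-adjacent to v, so with v they form a star
-- at u once uv is added.  If uv is an edge, there are a vertex ξ of a copy of H adjacent to
-- both and a coordinate i such that each of u, v either arises from ξ by changing coordinate i
-- or lies in K_R (then ξ is an anchor and i the first coordinate); changing ξ in one of the
-- other k−1 coordinates gives vertices non-adjacent to u and v, which together with u and v
-- form a star at ξ once uv is deleted.

module Submission where

open import Defs
open import Data.Bool using (true; false; not; _∧_)
open import Data.Bool.Properties using (∧-comm; ∨-comm; ∧-zeroʳ; ∧-conicalˡ; ∧-conicalʳ)
open import Data.Empty using (⊥-elim)
open import Data.Fin using (Fin; zero; suc; _≟_) renaming (_<_ to _<ᶠ_)
open import Data.Fin.Properties using (pigeonhole; suc-injective; <⇒≢; punchIn-injective; punchInᵢ≢i)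
open import Data.Nat using (ℕ; zero; suc; _≤_; _<_; _≡ᵇ_; _^_; _+_; _*_; z≤n; s≤s)
open import Data.Nat.Properties using (n<1+n; n≤1+n; ≤-refl; ≤-reflexive; ≤-trans; +-comm) renaming (suc-injective to suc-injective′)
open import Data.Sum using (inj₁; inj₂)
open import Data.Product using (Σ-syntax; ∃-syntax; _×_; _,_; proj₁; proj₂)
open import Data.Vec using (Vec; []; _∷_; lookup; replicate; _[_]≔_)
open import Data.Vec.Properties using ([]≔-lookup; []≔-idempotent; lookup∘update)
import Data.Vec.Functional as Vector
open import Function using (_∘_)
open import Function.Definitions using (Injective)
open import Relation.Nullary using (¬_; Dec; yes; no)
open import Relation.Nullary.Decidable using (⌊_⌋; dec-true; dec-false; isYes≗does)
open import Relation.Binary.PropositionalEquality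
  using (_≡_; _≢_; ≢-sym; refl; sym; trans; cong; cong₂; subst; subst₂; module ≡-Reasoning)

private
  variable
    A : Set
    k n : ℕ

⌊⌋-yes : (a? : Dec A) → A → ⌊ a? ⌋ ≡ true
⌊⌋-yes a? a = trans (isYes≗does a?) (dec-true a? a)

⌊⌋-no : (a? : Dec A) → ¬ A → ⌊ a? ⌋ ≡ false
⌊⌋-no a? ¬a = trans (isYes≗does a?) (dec-false a? ¬a)

⌊⌋-witness : {a? : Dec A} → ⌊ a? ⌋ ≡ true → A
⌊⌋-witness {a? = yes a} _ = a

∧-≡false-cong : ∀ {x y y′} → (x ≡ true → y ≡ false → y′ ≡ false) → x ∧ y ≡ false → x ∧ y′ ≡ false
∧-≡false-cong {false} _ _ = refl
∧-≡false-cong {true} f p = f refl p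

2≤⇒≢ᵇ1 : ∀ {n} → 2 ≤ n → (n ≡ᵇ 1) ≡ false
2≤⇒≢ᵇ1 (s≤s (s≤s _)) = refl

≡ᵇ1⇒≡1 : ∀ {n} → (n ≡ᵇ 1) ≡ true → n ≡ 1
≡ᵇ1⇒≡1 {suc zero} _ = refl

≢0-≢ᵇ1⇒2≤ : ∀ {n} → n ≢ 0 → (n ≡ᵇ 1) ≡ false → 2 ≤ n
≢0-≢ᵇ1⇒2≤ {zero}        n≢0 _ = ⊥-elim (n≢0 refl)
≢0-≢ᵇ1⇒2≤ {suc (suc n)} _   _ = s≤s (s≤s z≤n)

-- Induced stars and toggled pairs

AdjSymmetric : Graph → Set
AdjSymmetric X = ∀ x y → adj X x y ≡ adj X y x

AdjIrreflexive : Graph → Set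
AdjIrreflexive X = ∀ x → adj X x x ≡ false

module _ {X : Graph} where

  adj⇒≢ : AdjIrreflexive X → ∀ {x y} → adj X x y ≡ true → x ≢ y
  adj⇒≢ irr {x} p refl with () ← trans (sym p) (irr x)

  adj-separates : ∀ {x y z} → adj X x y ≡ true → adj X x z ≡ false → y ≢ z
  adj-separates p q refl with () ← trans (sym p) q

  record IsInducedStar (c : V X) (ℓ : Fin n → V X) : Set where
    field
      centre≢leaf     : ∀ i → c ≢ ℓ i
      leaves-distinct : ∀ {i j} → i ≢ j → ℓ i ≢ ℓ j
      centre-adj      : ∀ i → adj X c (ℓ i) ≡ true
      leaves-nonadj   : ∀ {i j} → i ≢ j → adj X (ℓ i) (ℓ j) ≡ false
  open IsInducedStar

  inducedStar⇒containsStar : AdjSymmetric X → ∀ {n c} {ℓ : Fin n → V X} →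
    IsInducedStar c ℓ → ContainsInduced (Star n) X
  inducedStar⇒containsStar adj-sym {n} {c} {ℓ} S = c Vector.∷ ℓ , injective , preserves
    where
    injective : Injective _≡_ _≡_ (c Vector.∷ ℓ)
    injective {zero}  {zero}  _ = refl
    injective {zero}  {suc j} e = ⊥-elim (centre≢leaf S j e)
    injective {suc i} {zero}  e = ⊥-elim (centre≢leaf S i (sym e))
    injective {suc i} {suc j} e with i ≟ j
    ... | yes i≡j = cong suc i≡j
    ... | no  i≢j = ⊥-elim (leaves-distinct S i≢j e)
    preserves : ∀ x y → x ≢ y → adj X ((c Vector.∷ ℓ) x) ((c Vector.∷ ℓ) y) ≡ adj (Star n) x y
    preserves zero    zero    x≢y = ⊥-elim (x≢y refl)
    preserves zero    (suc j) _   = centre-adj S j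
    preserves (suc i) zero    _   = trans (adj-sym (ℓ i) c) (centre-adj S i)
    preserves (suc i) (suc j) x≢y = leaves-nonadj S (x≢y ∘ cong suc)

  IsInducedStar-∘ : ∀ {m c} {ℓ : Fin n → V X} {σ : Fin m → Fin n} →
    IsInducedStar c ℓ → Injective _≡_ _≡_ σ → IsInducedStar c (ℓ ∘ σ)
  IsInducedStar-∘ {σ = σ} S σ-inj = record
    { centre≢leaf     = centre≢leaf S ∘ σ
    ; leaves-distinct = λ i≢j → leaves-distinct S (i≢j ∘ σ-inj)
    ; centre-adj      = centre-adj S ∘ σ
    ; leaves-nonadj   = λ i≢j → leaves-nonadj S (i≢j ∘ σ-inj)
    }

  IsInducedStar-∷ : AdjSymmetric X → ∀ {c x} {ℓ : Fin n → V X} → IsInducedStar c ℓ →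
    c ≢ x → (∀ i → x ≢ ℓ i) → adj X c x ≡ true → (∀ i → adj X x (ℓ i) ≡ false) →
    IsInducedStar c (x Vector.∷ ℓ)
  IsInducedStar-∷ adj-sym {c} {x} {ℓ} S c≢x x≢ℓ cx xℓ = record
    { centre≢leaf     = λ { zero → c≢x ; (suc i) → centre≢leaf S i }
    ; leaves-distinct = distinct
    ; centre-adj      = λ { zero → cx ; (suc i) → centre-adj S i }
    ; leaves-nonadj   = nonadj
    }
    where
    distinct : ∀ {i j} → i ≢ j → (x Vector.∷ ℓ) i ≢ (x Vector.∷ ℓ) j
    distinct {zero}  {zero}  i≢j = ⊥-elim (i≢j refl)
    distinct {zero}  {suc j} _   = x≢ℓ j
    distinct {suc i} {zero}  _   = x≢ℓ i ∘ sym
    distinct {suc i} {suc j} i≢j = leaves-distinct S (i≢j ∘ cong suc)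
    nonadj : ∀ {i j} → i ≢ j → adj X ((x Vector.∷ ℓ) i) ((x Vector.∷ ℓ) j) ≡ false
    nonadj {zero}  {zero}  i≢j = ⊥-elim (i≢j refl)
    nonadj {zero}  {suc j} _   = xℓ j
    nonadj {suc i} {zero}  _   = trans (adj-sym (ℓ i) x) (xℓ i)
    nonadj {suc i} {suc j} i≢j = leaves-nonadj S (i≢j ∘ cong suc)

module _ (G : Graph) (u v : V G) where
  private
    _≟G_ = _≟V_ G
    T = toggle G u v

  toggle-adj-uv : adj T u v ≡ not (adj G u v)
  toggle-adj-uv rewrite ⌊⌋-yes (u ≟G u) refl | ⌊⌋-yes (v ≟G v) refl = refl

  toggle-adj-outside : ∀ {x y} → y ≢ u → y ≢ v → adj T x y ≡ adj G x y
  toggle-adj-outside {x} {y} y≢u y≢v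
    rewrite ⌊⌋-no (y ≟G v) y≢v | ⌊⌋-no (y ≟G u) y≢u
          | ∧-zeroʳ ⌊ x ≟G u ⌋ | ∧-zeroʳ ⌊ x ≟G v ⌋ = refl

  toggle-symmetric : AdjSymmetric G → AdjSymmetric T
  toggle-symmetric adj-sym x y
    rewrite ∧-comm ⌊ x ≟G u ⌋ ⌊ y ≟G v ⌋ | ∧-comm ⌊ x ≟G v ⌋ ⌊ y ≟G u ⌋
          | ∨-comm (⌊ y ≟G v ⌋ ∧ ⌊ x ≟G u ⌋) (⌊ y ≟G u ⌋ ∧ ⌊ x ≟G v ⌋)
          | adj-sym x y = refl

  toggle-comm : ∀ {F} → ContainsInduced F (toggle G v u) → ContainsInduced F T
  toggle-comm (f , f-inj , f-adj) = f , f-inj , λ x y x≢y → trans (same-adj (f x) (f y)) (f-adj x y x≢y)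
    where
    same-adj : ∀ a b → adj T a b ≡ adj (toggle G v u) a b
    same-adj a b rewrite ∨-comm (⌊ a ≟G u ⌋ ∧ ⌊ b ≟G v ⌋) (⌊ a ≟G v ⌋ ∧ ⌊ b ≟G u ⌋) = refl

  IsInducedStar-toggle : ∀ {n c} {ℓ : Fin n → V G} → (∀ i → ℓ i ≢ u) → (∀ i → ℓ i ≢ v) →
    IsInducedStar {G} c ℓ → IsInducedStar {T} c ℓ
  IsInducedStar-toggle ℓ≢u ℓ≢v S = record
    { centre≢leaf     = centre≢leaf
    ; leaves-distinct = leaves-distinct
    ; centre-adj      = λ i → trans (toggle-adj-outside (ℓ≢u i) (ℓ≢v i)) (centre-adj i)
    ; leaves-nonadj   = λ {i} {j} i≢j → trans (toggle-adj-outside (ℓ≢u j) (ℓ≢v j)) (leaves-nonadj i≢j)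
    }
    where open IsInducedStar S

  module _ (adj-sym : AdjSymmetric G) (adj-irr : AdjIrreflexive G) {n} {ℓ : Fin n → V G} where

    star-after-adding : adj G u v ≡ false → u ≢ v → IsInducedStar {G} u ℓ →
      (∀ i → adj G v (ℓ i) ≡ false) → IsInducedStar {T} u (v Vector.∷ ℓ)
    star-after-adding uv u≢v S vℓ =
      IsInducedStar-∷ {T} (toggle-symmetric adj-sym) (IsInducedStar-toggle ℓ≢u ℓ≢v S) u≢v
        (λ i → adj-separates {G} (centre-adj i) uv ∘ sym)
        (trans toggle-adj-uv (cong not uv))
        (λ i → trans (toggle-adj-outside (ℓ≢u i) (ℓ≢v i)) (vℓ i))
      where
      open IsInducedStar S
      ℓ≢u : ∀ i → ℓ i ≢ u
      ℓ≢u i = centre≢leaf i ∘ sym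
      ℓ≢v : ∀ i → ℓ i ≢ v
      ℓ≢v i = adj-separates {G} (centre-adj i) uv

    star-after-deleting : ∀ {x} → adj G u v ≡ true → IsInducedStar {G} x ℓ →
      adj G x u ≡ true → adj G x v ≡ true →
      (∀ i → adj G u (ℓ i) ≡ false) → (∀ i → adj G v (ℓ i) ≡ false) →
      IsInducedStar {T} x (u Vector.∷ v Vector.∷ ℓ)
    star-after-deleting {x} uv S xu xv uℓ vℓ =
      IsInducedStar-∷ {T} T-sym
        (IsInducedStar-∷ {T} T-sym (IsInducedStar-toggle ℓ≢u ℓ≢v S) x≢v (λ i → ℓ≢v i ∘ sym)
          (centre-outside xv) (λ i → trans (toggle-adj-outside (ℓ≢u i) (ℓ≢v i)) (vℓ i)))
        x≢u
        (λ { zero → adj⇒≢ {G} adj-irr uv ; (suc i) → ℓ≢u i ∘ sym })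
        (centre-outside xu)
        (λ { zero → trans toggle-adj-uv (cong not uv)
           ; (suc i) → trans (toggle-adj-outside (ℓ≢u i) (ℓ≢v i)) (uℓ i) })
      where
      open IsInducedStar S
      T-sym : AdjSymmetric T
      T-sym = toggle-symmetric adj-sym
      x≢u : x ≢ u
      x≢u = adj⇒≢ {G} adj-irr xu
      x≢v : x ≢ v
      x≢v = adj⇒≢ {G} adj-irr xv
      ℓ≢u : ∀ i → ℓ i ≢ u
      ℓ≢u i = adj-separates {G} (trans (adj-sym v u) uv) (vℓ i) ∘ sym
      ℓ≢v : ∀ i → ℓ i ≢ v
      ℓ≢v i = adj-separates {G} uv (uℓ i) ∘ sym
      centre-outside : ∀ {y} → adj G x y ≡ true → adj T x y ≡ true
      centre-outside {y} xy = trans (T-sym x y) (trans (toggle-adj-outside x≢u x≢v) (trans (adj-sym y x) xy))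

record CliqueCover (X : Graph) (k : ℕ) (c : V X) : Set where
  field
    class        : ∀ x → adj X c x ≡ true → Fin k
    class-clique : ∀ {x y} p q → x ≢ y → class x p ≡ class y q → adj X x y ≡ true

cliqueCover⇒starFree : ∀ {X k} → (∀ c → CliqueCover X k c) → ¬ ContainsInduced (Star (suc k)) X
cliqueCover⇒starFree {X} {k} cover (f , f-inj , f-adj) = twoLeavesAdjacent (pigeonhole (n<1+n k) leafClass)
  where
  open CliqueCover (cover (f zero))
  leafClass : Fin (suc k) → Fin k
  leafClass i = class (f (suc i)) (f-adj zero (suc i) λ ())
  apart : ∀ {i j} → i <ᶠ j → suc i ≢ suc j
  apart i<j = <⇒≢ i<j ∘ suc-injective
  twoLeavesAdjacent : ¬ (∃[ i ] ∃[ j ] i <ᶠ j × leafClass i ≡ leafClass j)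
  twoLeavesAdjacent (i , j , i<j , same)
    with () ← trans (sym (class-clique _ _ (apart i<j ∘ f-inj) same)) (f-adj (suc i) (suc j) (apart i<j))

-- Hamming distance on [3]^k

third : (a b : Fin 3) → Σ[ c ∈ Fin 3 ] c ≢ a × c ≢ b
third zero             zero             = suc zero , (λ ()) , (λ ())
third zero             (suc zero)       = suc (suc zero) , (λ ()) , (λ ())
third zero             (suc (suc zero)) = suc zero , (λ ()) , (λ ())
third (suc zero)       zero             = suc (suc zero) , (λ ()) , (λ ())
third (suc (suc zero)) zero             = suc zero , (λ ()) , (λ ())
third (suc a)          (suc b)          = zero , (λ ()) , (λ ())

another : Fin 3 → Fin 3
another a = proj₁ (third a a)

another≢ : ∀ a → another a ≢ a
another≢ a = proj₁ (proj₂ (third a a))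

moveAt : Vec (Fin 3) k → Fin k → Vec (Fin 3) k
moveAt ξ j = ξ [ j ]≔ another (lookup ξ j)

diffCount-refl : (α : Vec (Fin 3) k) → diffCount α α ≡ 0
diffCount-refl []      = refl
diffCount-refl (a ∷ α) rewrite ⌊⌋-yes (a ≟ a) refl = diffCount-refl α

diffCount-sym : (α β : Vec (Fin 3) k) → diffCount α β ≡ diffCount β α
diffCount-sym []      []      = refl
diffCount-sym (a ∷ α) (b ∷ β) with a ≟ b | b ≟ a
... | yes _   | yes _   = diffCount-sym α β
... | no  _   | no  _   = cong suc (diffCount-sym α β)
... | yes a≡b | no  b≢a = ⊥-elim (b≢a (sym a≡b))
... | no  a≢b | yes b≡a = ⊥-elim (a≢b (sym b≡a))

diffCount≡0⇒≡ : (α β : Vec (Fin 3) k) → diffCount α β ≡ 0 → α ≡ β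
diffCount≡0⇒≡ []      []      _ = refl
diffCount≡0⇒≡ (a ∷ α) (b ∷ β) d with a ≟ b
... | yes a≡b = cong₂ _∷_ a≡b (diffCount≡0⇒≡ α β d)
diffCount≡0⇒≡ (a ∷ α) (b ∷ β) () | no _

diffCount-[]≔ : ∀ (α : Vec (Fin 3) k) i {s t} → s ≢ t → diffCount (α [ i ]≔ s) (α [ i ]≔ t) ≡ 1
diffCount-[]≔ (a ∷ α) zero    {s} {t} s≢t rewrite ⌊⌋-no (s ≟ t) s≢t = cong suc (diffCount-refl α)
diffCount-[]≔ (a ∷ α) (suc i) s≢t rewrite ⌊⌋-yes (a ≟ a) refl = diffCount-[]≔ α i s≢t

diffCount-update : ∀ (α : Vec (Fin 3) k) i {t} → t ≢ lookup α i → diffCount α (α [ i ]≔ t) ≡ 1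
diffCount-update α i {t} t≢αi = begin
  diffCount α (α [ i ]≔ t)                     ≡⟨ cong (λ β → diffCount β (α [ i ]≔ t)) ([]≔-lookup α i) ⟨
  diffCount (α [ i ]≔ lookup α i) (α [ i ]≔ t) ≡⟨ diffCount-[]≔ α i (≢-sym t≢αi) ⟩
  1                                            ∎
  where open ≡-Reasoning

diffCount-[]≔-[]≔ : ∀ (α : Vec (Fin 3) k) {i j s t} → i ≢ j → s ≢ lookup α i → t ≢ lookup α j →
  diffCount (α [ i ]≔ s) (α [ j ]≔ t) ≡ 2
diffCount-[]≔-[]≔ (a ∷ α) {zero}  {zero}  i≢j _ _ = ⊥-elim (i≢j refl)
diffCount-[]≔-[]≔ (a ∷ α) {zero}  {suc j} {s} _ s≢a t≢αj
  rewrite ⌊⌋-no (s ≟ a) s≢a = cong suc (diffCount-update α j t≢αj)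
diffCount-[]≔-[]≔ (a ∷ α) {suc i} {zero}  {s} {t} _ s≢αi t≢a
  rewrite ⌊⌋-no (a ≟ t) (≢-sym t≢a) | diffCount-sym (α [ i ]≔ s) α = cong suc (diffCount-update α i s≢αi)
diffCount-[]≔-[]≔ (a ∷ α) {suc i} {suc j} i≢j s≢αi t≢αj
  rewrite ⌊⌋-yes (a ≟ a) refl = diffCount-[]≔-[]≔ α (i≢j ∘ cong suc) s≢αi t≢αj

diffCount-[]≔-mono : ∀ (α β : Vec (Fin 3) k) j {t} → t ≢ lookup β j →
  diffCount α β ≤ diffCount (α [ j ]≔ t) β
diffCount-[]≔-mono (a ∷ α) (b ∷ β) zero {t} t≢b with t ≟ b | a ≟ b
... | yes t≡b | _     = ⊥-elim (t≢b t≡b)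
... | no  _   | yes _ = n≤1+n _
... | no  _   | no  _ = ≤-refl
diffCount-[]≔-mono (a ∷ α) (b ∷ β) (suc j) t≢βj with a ≟ b
... | yes _ = diffCount-[]≔-mono α β j t≢βj
... | no  _ = s≤s (diffCount-[]≔-mono α β j t≢βj)

diffCount≡1⇒[]≔ : ∀ (α β : Vec (Fin 3) k) → diffCount α β ≡ 1 →
  Σ[ i ∈ Fin k ] lookup α i ≢ lookup β i × β ≡ α [ i ]≔ lookup β i
diffCount≡1⇒[]≔ []      []      ()
diffCount≡1⇒[]≔ (a ∷ α) (b ∷ β) d with a ≟ b
... | no  a≢b = zero , a≢b , cong (b ∷_) (sym (diffCount≡0⇒≡ α β (suc-injective′ d)))
... | yes a≡b with i , αi≢βi , β≡ ← diffCount≡1⇒[]≔ α β d = suc i , αi≢βi , cong₂ _∷_ (sym a≡b) β≡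

allOne⇒lookup : ∀ (α : Vec (Fin 3) k) j → allOne α ≡ true → lookup α j ≡ zero
allOne⇒lookup (zero ∷ α) zero    _ = refl
allOne⇒lookup (zero ∷ α) (suc j) p = allOne⇒lookup α j p

allOne-[]≔ : ∀ (α : Vec (Fin 3) k) j {t} → t ≢ zero → allOne (α [ j ]≔ t) ≡ false
allOne-[]≔ (a ∷ α) zero    {zero}  t≢0 = ⊥-elim (t≢0 refl)
allOne-[]≔ (a ∷ α) zero    {suc t} _   = refl
allOne-[]≔ (a ∷ α) (suc j) t≢0 rewrite allOne-[]≔ α j t≢0 = ∧-zeroʳ (isZero a)

allOne-replicate : ∀ k → allOne (replicate k (zero {2})) ≡ true
allOne-replicate zero    = refl
allOne-replicate (suc k) = allOne-replicate k

allOne-unique : ∀ (α β : Vec (Fin 3) k) → allOne α ≡ true → allOne β ≡ true → α ≡ β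
allOne-unique []         []         _ _ = refl
allOne-unique (zero ∷ α) (zero ∷ β) p q = cong (zero ∷_) (allOne-unique α β p q)

isAnchor-[]≔ : ∀ (α : Vec (Fin 3) k) j {t} → t ≢ zero → isAnchor α ≡ false → isAnchor (α [ j ]≔ t) ≡ false
isAnchor-[]≔ (a ∷ α) zero    _   p = p
isAnchor-[]≔ (a ∷ α) (suc j) t≢0 _ = allOne-[]≔ α j t≢0

isAnchor-moved : ∀ (ξ : Vec (Fin 3) (suc k)) j → j ≢ zero → isAnchor ξ ≡ true →
  isAnchor (moveAt ξ j) ≡ false
isAnchor-moved (a ∷ ξ) zero    j≢0 _ = ⊥-elim (j≢0 refl)
isAnchor-moved (a ∷ ξ) (suc j) _   p = allOne-[]≔ ξ j (subst (another (lookup ξ j) ≢_) (allOne⇒lookup ξ j p) (another≢ _))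

anchors-adjacent : ∀ (α β : Vec (Fin 3) k) → isAnchor α ≡ true → isAnchor β ≡ true → α ≢ β → diffCount α β ≡ 1
anchors-adjacent (a ∷ α) (b ∷ β) p q α≢β with refl ← allOne-unique α β p q =
  diffCount-[]≔ (a ∷ α) zero (α≢β ∘ cong (_∷ α))

isZero-unique : ∀ {z} (c d : Fin z) → isZero c ≡ true → isZero d ≡ true → c ≡ d
isZero-unique zero zero _ _ = refl

-- The graph G

pattern inH c α = inj₁ (c , α)
pattern inK r   = inj₂ r

module Construction (m z R : ℕ) where
  private
    G = Gconstr (suc m) z R

  Gconstr-symmetric : AdjSymmetric G
  Gconstr-symmetric (inH c α) (inH d β) with c ≟ d
  ... | yes refl rewrite ⌊⌋-yes (c ≟ c) refl | diffCount-sym α β = refl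
  ... | no  c≢d  rewrite ⌊⌋-no (d ≟ c) (≢-sym c≢d) = refl
  Gconstr-symmetric (inH _ _) (inK _) = refl
  Gconstr-symmetric (inK _) (inH _ _) = refl
  Gconstr-symmetric (inK r) (inK s) with r ≟ s
  ... | yes refl rewrite ⌊⌋-yes (r ≟ r) refl = refl
  ... | no  r≢s  rewrite ⌊⌋-no (s ≟ r) (≢-sym r≢s) = refl

  Gconstr-irreflexive : AdjIrreflexive G
  Gconstr-irreflexive (inH c α) rewrite ⌊⌋-yes (c ≟ c) refl | diffCount-refl α = refl
  Gconstr-irreflexive (inK r)   rewrite ⌊⌋-yes (r ≟ r) refl = refl

  adjHH⇒ : ∀ c d α β → adj G (inH c α) (inH d β) ≡ true →
    Σ[ i ∈ Fin (suc m) ] c ≡ d × lookup α i ≢ lookup β i × β ≡ α [ i ]≔ lookup β i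
  adjHH⇒ c d α β p with i , αi≢βi , β≡ ← diffCount≡1⇒[]≔ α β (≡ᵇ1⇒≡1 (∧-conicalʳ _ _ p)) =
    i , ⌊⌋-witness {a? = c ≟ d} (∧-conicalˡ _ _ p) , αi≢βi , β≡

  adjHH : ∀ c α β → diffCount α β ≡ 1 → adj G (inH c α) (inH c β) ≡ true
  adjHH c α β d rewrite ⌊⌋-yes (c ≟ c) refl | d = refl

  adjHH-far : ∀ c d α β → 2 ≤ diffCount α β → adj G (inH c α) (inH d β) ≡ false
  adjHH-far c d α β 2≤d rewrite 2≤⇒≢ᵇ1 2≤d = ∧-zeroʳ ⌊ c ≟ d ⌋

  adjKH-nonanchor : ∀ r c α → isAnchor α ≡ false → adj G (inK r) (inH c α) ≡ false
  adjKH-nonanchor r c α p rewrite p = ∧-zeroʳ (isZero c)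

  adjKK : ∀ {r s} → r ≢ s → adj G (inK r) (inK s) ≡ true
  adjKK {r} {s} r≢s rewrite ⌊⌋-no (r ≟ s) r≢s = refl

  cube-distinct : ∀ {c d} α β {n} → diffCount α β ≡ suc n → _≢_ {A = V G} (inH c α) (inH d β)
  cube-distinct α _ eq refl with () ← trans (sym (diffCount-refl α)) eq

  cube-star : ∀ c α (t : Fin (suc m) → Fin 3) → (∀ j → t j ≢ lookup α j) →
    IsInducedStar {G} (inH c α) (λ j → inH c (α [ j ]≔ t j))
  cube-star c α t t≢α = record
    { centre≢leaf     = λ j → cube-distinct α _ (diffCount-update α j (t≢α j))
    ; leaves-distinct = λ i≢j → cube-distinct _ _ (leaves-apart i≢j)
    ; centre-adj      = λ j → adjHH c α _ (diffCount-update α j (t≢α j))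
    ; leaves-nonadj   = λ {i} {j} i≢j →
        adjHH-far c c (α [ i ]≔ t i) (α [ j ]≔ t j) (≤-reflexive (sym (leaves-apart i≢j)))
    }
    where
    leaves-apart : ∀ {i j} → i ≢ j → diffCount (α [ i ]≔ t i) (α [ j ]≔ t j) ≡ 2
    leaves-apart i≢j = diffCount-[]≔-[]≔ α i≢j (t≢α _) (t≢α _)

  cliqueCover-K : ∀ r → CliqueCover G (suc m) (inK r)
  cliqueCover-K r = record { class = λ _ _ → zero ; class-clique = clique }
    where
    clique : ∀ {x y} → adj G (inK r) x ≡ true → adj G (inK r) y ≡ true → x ≢ y → zero ≡ zero → adj G x y ≡ true
    clique {inK s}   {inK t}   _ _ s≢t _ = adjKK (s≢t ∘ cong inj₂)
    clique {inK _}   {inH _ _} _ q _   _ = q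
    clique {inH _ _} {inK _}   p _ _   _ = p
    clique {inH c α} {inH d β} p q α≢β _ with refl ← isZero-unique c d (∧-conicalˡ _ _ p) (∧-conicalˡ _ _ q) =
      adjHH c α β (anchors-adjacent α β (∧-conicalʳ _ _ p) (∧-conicalʳ _ _ q) (α≢β ∘ cong (inH c)))

  cliqueCover-H : ∀ c α → CliqueCover G (suc m) (inH c α)
  cliqueCover-H c α@(a ∷ as) = record { class = class ; class-clique = clique }
    where
    Neighbour : Fin z → Vec (Fin 3) (suc m) → Set
    Neighbour d β = Σ[ i ∈ Fin (suc m) ] c ≡ d × lookup α i ≢ lookup β i × β ≡ α [ i ]≔ lookup β i

    class : ∀ x → adj G (inH c α) x ≡ true → Fin (suc m)
    class (inH d β) p = proj₁ (adjHH⇒ c d α β p)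
    class (inK _)   _ = zero

    anchored : ∀ {r d β} → adj G (inH c α) (inK r) ≡ true → (N : Neighbour d β) → proj₁ N ≡ zero →
      adj G (inK r) (inH d β) ≡ true
    anchored {r} p (zero , refl , _ , β≡) _ = subst (λ γ → adj G (inK r) (inH c γ) ≡ true) (sym β≡) p

    same-coordinate : ∀ {d d′ β γ} (N : Neighbour d β) (N′ : Neighbour d′ γ) → proj₁ N ≡ proj₁ N′ →
      _≢_ {A = V G} (inH d β) (inH d′ γ) → adj G (inH d β) (inH d′ γ) ≡ true
    same-coordinate {β = β} {γ} (i , refl , _ , β≡) (.i , refl , _ , γ≡) refl β≢γ = adjHH c β γ (begin
      diffCount β γ                                        ≡⟨ cong₂ diffCount β≡ γ≡ ⟩
      diffCount (α [ i ]≔ lookup β i) (α [ i ]≔ lookup γ i) ≡⟨ diffCount-[]≔ α i βi≢γi ⟩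
      1                                                    ∎)
      where
      open ≡-Reasoning
      βi≢γi : lookup β i ≢ lookup γ i
      βi≢γi βi≡γi = β≢γ (cong (inH c) (trans β≡ (trans (cong (α [ i ]≔_) βi≡γi) (sym γ≡))))

    clique : ∀ {x y} p q → x ≢ y → class x p ≡ class y q → adj G x y ≡ true
    clique {inK r}   {inK s}    _ _ r≢s _ = adjKK (r≢s ∘ cong inj₂)
    clique {inK r}   {inH d β}  p q _   e = anchored {r} p (adjHH⇒ c d α β q) (sym e)
    clique {inH d β} {inK r}    p q _   e = anchored {r} q (adjHH⇒ c d α β p) e
    clique {inH d β} {inH d′ γ} p q x≢y e = same-coordinate (adjHH⇒ c d α β p) (adjHH⇒ c d′ α γ q) e x≢y

  Gconstr-starFree : ¬ ContainsInduced (Star (suc (suc m))) G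
  Gconstr-starFree = cliqueCover⇒starFree λ { (inH c α) → cliqueCover-H c α ; (inK r) → cliqueCover-K r }

  private
    Star′ = Star (suc (suc m))

  avoided : V G → Fin (suc m) → Fin 3
  avoided (inH _ β) j = lookup β j
  avoided (inK _)   _ = zero

  nonadj-to-cube-neighbours : ∀ c α v → inH c α ≢ v → adj G (inH c α) v ≡ false →
    ∀ j {t} → t ≢ avoided v j → adj G v (inH c (α [ j ]≔ t)) ≡ false
  nonadj-to-cube-neighbours c α (inH d β) u≢v uv j {t} t≢βj =
    trans (Gconstr-symmetric (inH d β) (inH c (α [ j ]≔ t))) (∧-≡false-cong far uv)
    where
    far : ⌊ c ≟ d ⌋ ≡ true → hamAdj α β ≡ false → hamAdj (α [ j ]≔ t) β ≡ false
    far c≡d αβ with refl ← ⌊⌋-witness {a? = c ≟ d} c≡d = 2≤⇒≢ᵇ1 (≤-trans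
      (≢0-≢ᵇ1⇒2≤ (u≢v ∘ cong (inH c) ∘ diffCount≡0⇒≡ α β) αβ)
      (diffCount-[]≔-mono α β j t≢βj))
  nonadj-to-cube-neighbours c α (inK r) _ uv j t≢0 = ∧-≡false-cong (λ _ → isAnchor-[]≔ α j t≢0) uv

  adding-creates-star : ∀ c α v → inH c α ≢ v → adj G (inH c α) v ≡ false →
    ContainsInduced Star′ (toggle G (inH c α) v)
  adding-creates-star c α v u≢v uv =
    inducedStar⇒containsStar (toggle-symmetric G u v Gconstr-symmetric)
      (star-after-adding G u v Gconstr-symmetric Gconstr-irreflexive uv u≢v (cube-star c α t t≢α)
        (λ j → nonadj-to-cube-neighbours c α v u≢v uv j (t≢avoided j)))
    where
    u = inH c α
    t : Fin (suc m) → Fin 3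
    t j = proj₁ (third (lookup α j) (avoided v j))
    t≢α : ∀ j → t j ≢ lookup α j
    t≢α j = proj₁ (proj₂ (third (lookup α j) (avoided v j)))
    t≢avoided : ∀ j → t j ≢ avoided v j
    t≢avoided j = proj₂ (proj₂ (third (lookup α j) (avoided v j)))

  deleting-creates-star : ∀ c ξ i {u v} → adj G u v ≡ true →
    adj G (inH c ξ) u ≡ true → adj G (inH c ξ) v ≡ true →
    (∀ j → j ≢ i → adj G u (inH c (moveAt ξ j)) ≡ false) →
    (∀ j → j ≢ i → adj G v (inH c (moveAt ξ j)) ≡ false) →
    ContainsInduced Star′ (toggle G u v)
  deleting-creates-star c ξ i {u} {v} uv xu xv uℓ vℓ =
    inducedStar⇒containsStar (toggle-symmetric G u v Gconstr-symmetric)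
      (star-after-deleting G u v Gconstr-symmetric Gconstr-irreflexive uv
        (IsInducedStar-∘ (cube-star c ξ (another ∘ lookup ξ) (another≢ ∘ lookup ξ)) (punchIn-injective i _ _))
        xu xv (λ j → uℓ _ (punchInᵢ≢i i j)) (λ j → vℓ _ (punchInᵢ≢i i j)))

  cube-nonadj-moved : ∀ c ξ i j {a} → a ≢ lookup ξ i → j ≢ i →
    adj G (inH c (ξ [ i ]≔ a)) (inH c (moveAt ξ j)) ≡ false
  cube-nonadj-moved c ξ i j a≢ξi j≢i = adjHH-far c c (ξ [ i ]≔ _) (moveAt ξ j)
    (≤-reflexive (sym (diffCount-[]≔-[]≔ ξ (≢-sym j≢i) a≢ξi (another≢ _))))

  clique-nonadj-moved : ∀ r c ξ j → j ≢ zero → isAnchor ξ ≡ true →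
    adj G (inK r) (inH c (moveAt ξ j)) ≡ false
  clique-nonadj-moved r c ξ j j≢0 ξ-anchor = adjKH-nonanchor r c (moveAt ξ j) (isAnchor-moved ξ j j≢0 ξ-anchor)

  cube-edge-deletion : ∀ c ξ i {a b} → a ≢ lookup ξ i → b ≢ lookup ξ i → a ≢ b →
    ContainsInduced Star′ (toggle G (inH c (ξ [ i ]≔ a)) (inH c (ξ [ i ]≔ b)))
  cube-edge-deletion c ξ i {a} {b} a≢ξi b≢ξi a≢b = deleting-creates-star c ξ i
    (adjHH c (ξ [ i ]≔ a) (ξ [ i ]≔ b) (diffCount-[]≔ ξ i a≢b))
    (adjHH c ξ _ (diffCount-update ξ i a≢ξi))
    (adjHH c ξ _ (diffCount-update ξ i b≢ξi))
    (λ j → cube-nonadj-moved c ξ i j a≢ξi)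
    (λ j → cube-nonadj-moved c ξ i j b≢ξi)

  deleting-at-cube : ∀ c α v → adj G (inH c α) v ≡ true → ContainsInduced Star′ (toggle G (inH c α) v)
  deleting-at-cube c α (inH d β) uv with i , refl , αi≢βi , β≡ ← adjHH⇒ c d α β uv =
    subst₂ (λ α′ β′ → ContainsInduced Star′ (toggle G (inH c α′) (inH c β′)))
      α≡ (trans ([]≔-idempotent α i) (sym β≡))
      (cube-edge-deletion c (α [ i ]≔ e) i (e≢αi ∘ sym ∘ ξi≡e) (e≢βi ∘ sym ∘ ξi≡e) αi≢βi)
    where
    -- ξ = α [ i ]≔ e agrees with α and β off coordinate i and differs from both at i.
    e = proj₁ (third (lookup α i) (lookup β i))
    e≢αi = proj₁ (proj₂ (third (lookup α i) (lookup β i)))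
    e≢βi = proj₂ (proj₂ (third (lookup α i) (lookup β i)))
    ξi≡e : ∀ {x} → x ≡ lookup (α [ i ]≔ e) i → x ≡ e
    ξi≡e x≡ = trans x≡ (lookup∘update i α e)
    α≡ : α [ i ]≔ e [ i ]≔ lookup α i ≡ α
    α≡ = trans ([]≔-idempotent α i) ([]≔-lookup α i)
  deleting-at-cube c (a ∷ as) (inK r) uv = deleting-creates-star c (another a ∷ as) zero uv
    (adjHH c (another a ∷ as) (a ∷ as) (diffCount-update (another a ∷ as) zero (≢-sym (another≢ a))))
    uv
    (λ j → cube-nonadj-moved c (another a ∷ as) zero j (≢-sym (another≢ a)))
    (λ j j≢0 → clique-nonadj-moved r c (another a ∷ as) j j≢0 (∧-conicalʳ _ _ uv))

  toggle-at-cube : ∀ c α v → inH c α ≢ v → ContainsInduced Star′ (toggle G (inH c α) v)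
  toggle-at-cube c α v u≢v with adj G (inH c α) v in uv
  ... | false = adding-creates-star c α v u≢v uv
  ... | true  = deleting-at-cube c α v uv

  -- An edge inside K_R is deleted around an anchor of the copy o that is joined to K_R.
  toggle-creates-star : (o : Fin z) → isZero o ≡ true →
    ∀ u v → u ≢ v → ContainsInduced Star′ (toggle G u v)
  toggle-creates-star _ _ (inH c α) v u≢v = toggle-at-cube c α v u≢v
  toggle-creates-star _ _ (inK r) (inH c α) u≢v =
    toggle-comm G (inK r) (inH c α) {Star′} (toggle-at-cube c α (inK r) (≢-sym u≢v))
  toggle-creates-star o o-zero (inK r) (inK s) u≢v =
    deleting-creates-star o ξ zero (adjKK (u≢v ∘ cong inj₂)) (ξ-adj {r}) (ξ-adj {s})
      (λ j j≢0 → clique-nonadj-moved r o ξ j j≢0 ξ-anchor)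
      (λ j j≢0 → clique-nonadj-moved s o ξ j j≢0 ξ-anchor)
    where
    ξ : Vec (Fin 3) (suc m)
    ξ = zero ∷ replicate m zero
    ξ-anchor : isAnchor ξ ≡ true
    ξ-anchor = allOne-replicate m
    ξ-adj : ∀ {t} → adj G (inH o ξ) (inK t) ≡ true
    ξ-adj rewrite o-zero | ξ-anchor = refl

Gconstr-inducedSaturated : ∀ m z R → InducedSaturated (Star (suc (suc m))) (Gconstr (suc m) (suc z) R)
Gconstr-inducedSaturated m z R = Gconstr-starFree , toggle-creates-star zero refl
  where open Construction m (suc z) R

-- The construction is saturated for every R; n and the bounds on R only fix its parameters.
proposition3p2 : (k n z R : ℕ) → 2 ≤ k → 3 ^ k ≤ n → 1 ≤ z → R < 3 ^ k →
    n ≡ z * 3 ^ k + R → InducedSaturated (Star (k + 1)) (Gconstr k z R)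
proposition3p2 k@(suc (suc m)) _ (suc z) R (s≤s (s≤s _)) _ (s≤s _) _ _ =
  subst (λ s → InducedSaturated (Star s) (Gconstr k (suc z) R)) (+-comm 1 k) (Gconstr-inducedSaturated (suc m) z R)
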